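{- Let $\Gamma=K_{n,n}-nK_2$ with $n\geqslant 3$, and let $G\leqslant\mathrm{Aut}(\Gamma)$ be transitive on vertices and edges with $G^+=\mathrm{Diag}(\mathrm{Sym}(n)\times\mathrm{Sym}(n))$. Then $D(G)=\lfloor\sqrt n\rfloor+1$.
   Context: $D(G)$ is the smallest $k$ such that there is a partition of the vertex set into $k$ parts whose setwise stabilisers in $G$ intersect trivially. $\Gamma$ has parts $\Delta=\{v_1,\dots,v_n\}$, $\Delta'=\{u_1,\dots,u_n\}$, with non-edges exactly $\{v_i,u_i\}$ (the crown graph). $(g,g')\in\mathrm{Sym}(n)\times\mathrm{Sym}(n)$ acts by $v_i\mapsto v_{i^g}$, $u_i\mapsto u_{i^{g'}}$; $G^+$ is the index-two subgroup of $G$ preserving each part, and $\mathrm{Diag}(\mathrm{Sym}(n)\times\mathrm{Sym}(n))=\{(h,h):h\in\mathrm{Sym}(n)\}$. -}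

module Defs where

open import Data.Nat using (ℕ; _<_)
open import Data.Fin using (Fin)
open import Data.Fin.Permutation using (Permutation′; _⟨$⟩ʳ_)
open import Data.Sum using (_⊎_; inj₁; inj₂)
open import Data.Product using (Σ; _×_; _,_; ∃)
open import Data.Empty using (⊥)
open import Function.Bundles using (_⇔_)
open import Relation.Binary.PropositionalEquality using (_≡_; _≢_)
open import Relation.Nullary using (¬_)

-- Vertices of the crown graph K_{n,n} - nK_2:
-- inj₁ i = v_i ∈ Δ,  inj₂ i = u_i ∈ Δ'.
Vertex : ℕ → Set
Vertex n = Fin n ⊎ Fin n

Adj : ∀ {n} → Vertex n → Vertex n → Set
Adj (inj₁ i) (inj₂ j) = i ≢ j
Adj (inj₂ i) (inj₁ j) = i ≢ j
Adj (inj₁ _) (inj₁ _) = ⊥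
Adj (inj₂ _) (inj₂ _) = ⊥

-- A set of maps on the vertex set (elements of G are given by their action).
VSet : ℕ → Set₁
VSet n = (Vertex n → Vertex n) → Set

_≗_ : ∀ {n} → (Vertex n → Vertex n) → (Vertex n → Vertex n) → Set
f ≗ g = ∀ x → f x ≡ g x

record IsAutSubgroup {n : ℕ} (G : VSet n) : Set where
  field
    respects : ∀ {f g} → f ≗ g → G f → G g
    hasId    : G (λ x → x)
    closed∘  : ∀ {f g} → G f → G g → G (λ x → f (g x))
    hasInv   : ∀ {f} → G f →
               Σ (Vertex n → Vertex n) λ h → G h × (∀ x → h (f x) ≡ x) × (∀ x → f (h x) ≡ x)
    isAut    : ∀ {f} → G f → ∀ x y → Adj x y ⇔ Adj (f x) (f y)

VertexTransitive : ∀ {n} → VSet n → Set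
VertexTransitive {n} G = ∀ (x y : Vertex n) → Σ (Vertex n → Vertex n) λ g → G g × g x ≡ y

EdgeTransitive : ∀ {n} → VSet n → Set
EdgeTransitive {n} G = ∀ (a b c d : Vertex n) → Adj a b → Adj c d →
  Σ (Vertex n → Vertex n) λ g → G g × ((g a ≡ c × g b ≡ d) ⊎ (g a ≡ d × g b ≡ c))

PreservesParts : ∀ {n} → (Vertex n → Vertex n) → Set
PreservesParts {n} g =
  (∀ (i : Fin n) → Σ (Fin n) λ j → g (inj₁ i) ≡ inj₁ j) ×
  (∀ (i : Fin n) → Σ (Fin n) λ j → g (inj₂ i) ≡ inj₂ j)

GPlus : ∀ {n} → VSet n → VSet n
GPlus G g = G g × PreservesParts g

diag : ∀ {n} → Permutation′ n → Vertex n → Vertex n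
diag h (inj₁ i) = inj₁ (h ⟨$⟩ʳ i)
diag h (inj₂ i) = inj₂ (h ⟨$⟩ʳ i)

Diag : ∀ {n} → VSet n
Diag g = ∃ λ h → g ≗ diag h

_≐_ : ∀ {n} → VSet n → VSet n → Set
A ≐ B = ∀ g → A g ⇔ B g

StabilisesPart : ∀ {n k} → (Vertex n → Fin k) → Fin k → (Vertex n → Vertex n) → Set
StabilisesPart {n} c i g =
  (∀ v → c v ≡ i → c (g v) ≡ i) ×
  (∀ w → c w ≡ i → Σ (Vertex n) λ v → c v ≡ i × g v ≡ w)

-- a partition into k parts (indexed by Fin k) whose setwise stabilisers in G
-- intersect trivially
Distinguishing : ∀ {n} → VSet n → ℕ → Set
Distinguishing {n} G k = Σ (Vertex n → Fin k) λ c →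
  ∀ g → G g → (∀ i → StabilisesPart c i g) → ∀ v → g v ≡ v

DistNumberIs : ∀ {n} → VSet n → ℕ → Set
DistNumberIs G m = Distinguishing G m × (∀ k → k < m → ¬ Distinguishing G k)

{-# OPTIONS --safe #-}
-- Record a colouring c of the crown graph by its code i ↦ (c v_i , c u_i).  For n ≥ 3 every
-- automorphism is diag π or antidiag π (diag π followed by exchanging the two parts).  Hence a
-- colouring is distinguishing as soon as its code is injective and misses the swap of one of its
-- values; conversely, since G contains every diag π and (being vertex-transitive) every antidiag π,
-- a distinguishing code must be injective and must not be closed under swapping coordinates.
-- With s + 1 colours the bound n < (s + 1)² leaves a pair free for such a code; with k ≤ s
-- colours, k² ≤ n forces an injective code to be onto, hence closed under swapping.
module Submission where

open import Defs
open import Data.Nat using (ℕ; suc; _+_; _*_; _≤_; _<_; s≤s; z≤n)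
import Data.Nat.Properties as ℕ
open import Data.Bool using (Bool; true; false; not)
open import Data.Fin
  using (Fin; zero; suc; toℕ; fromℕ; inject₁; inject≤; combine; remQuot; opposite; punchOut; _≟_)
import Data.Fin.Properties as Fin
open import Data.Fin.Permutation as Perm using (Permutation′; _⟨$⟩ʳ_; _∘ₚ_; permutation)
import Data.Fin.Permutation.Components as PC
open import Data.Sum using (_⊎_; inj₁; inj₂)
open import Data.Product using (Σ; _×_; _,_; ∃; proj₁; proj₂; swap; map₂; uncurry)
open import Data.Empty using (⊥-elim)
open import Function using (_∘_; id)
open import Function.Bundles using (_⇔_; Equivalence)
open import Function.Definitions using (Injective; StrictlySurjective)
open import Relation.Binary.PropositionalEquality hiding (_≗_)
open import Relation.Nullary using (¬_; yes; no; contradiction)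
open import Relation.Nullary.Decidable using (decidable-stable)

injective⇒strictlySurjective : ∀ {m n} → n ≤ m → (f : Fin m → Fin n) →
  Injective _≡_ _≡_ f → StrictlySurjective _≡_ f
injective⇒strictlySurjective {n = suc n} n<m f f-inj y with Fin.any? (λ x → f x ≟ y)
... | yes hit = hit
... | no miss = ⊥-elim (Fin.<⇒notInjective n<m f′-inj)
  where
  f′ : Fin _ → Fin n
  f′ x = punchOut {i = y} {j = f x} (λ y≡fx → miss (x , sym y≡fx))
  f′-inj : Injective _≡_ _≡_ f′
  f′-inj eq = f-inj (Fin.punchOut-injective {i = y} _ _ eq)

injective⇒permutation : ∀ {n} (f : Fin n → Fin n) → Injective _≡_ _≡_ f → Permutation′ n
injective⇒permutation f f-inj =
  permutation f (proj₁ ∘ onto) (proj₂ ∘ onto) (λ x → f-inj (proj₂ (onto (f x))))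
  where onto = injective⇒strictlySurjective ℕ.≤-refl f f-inj

avoid-two : ∀ {m} (a b : Fin (3 + m)) → ∃ λ k → k ≢ a × k ≢ b
avoid-two zero          zero          = suc zero , (λ ()) , (λ ())
avoid-two zero          (suc zero)    = suc (suc zero) , (λ ()) , (λ ())
avoid-two zero          (suc (suc _)) = suc zero , (λ ()) , (λ ())
avoid-two (suc zero)    zero          = suc (suc zero) , (λ ()) , (λ ())
avoid-two (suc zero)    (suc zero)    = zero , (λ ()) , (λ ())
avoid-two (suc zero)    (suc (suc _)) = zero , (λ ()) , (λ ())
avoid-two (suc (suc _)) zero          = suc zero , (λ ()) , (λ ())
avoid-two (suc (suc _)) (suc zero)    = zero , (λ ()) , (λ ())
avoid-two (suc (suc _)) (suc (suc _)) = zero , (λ ()) , (λ ())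

transpose-i≡j : ∀ {n} (i j : Fin n) → PC.transpose i j i ≡ j
transpose-i≡j i j with i ≟ i
... | yes _ = refl
... | no i≢i = contradiction refl i≢i

transpose-preserves : ∀ {n} {A : Set} (F : Fin n → A) (i j : Fin n) → F i ≡ F j →
  ∀ x → F (PC.transpose i j x) ≡ F x
transpose-preserves F i j Fi≡Fj x with x ≟ i
... | yes refl = sym Fi≡Fj
... | no _ with x ≟ j
...   | yes refl = Fi≡Fj
...   | no _ = refl

combine-fromℕ : ∀ a b → combine (fromℕ a) (fromℕ b) ≡ fromℕ (b + a * suc b)
combine-fromℕ a b = Fin.toℕ-injective (begin
  toℕ (combine (fromℕ a) (fromℕ b))         ≡⟨ Fin.toℕ-combine (fromℕ a) (fromℕ b) ⟩
  suc b * toℕ (fromℕ a) + toℕ (fromℕ b)     ≡⟨ cong₂ (λ x y → suc b * x + y)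
                                                   (Fin.toℕ-fromℕ a) (Fin.toℕ-fromℕ b) ⟩
  suc b * a + b                             ≡⟨ ℕ.+-comm (suc b * a) b ⟩
  b + suc b * a                             ≡⟨ cong (b +_) (ℕ.*-comm (suc b) a) ⟩
  b + a * suc b                             ≡⟨ Fin.toℕ-fromℕ _ ⟨
  toℕ (fromℕ (b + a * suc b))               ∎)
  where open ≡-Reasoning

remQuot-injective : ∀ {m} n → Injective _≡_ _≡_ (remQuot {m} n)
remQuot-injective {m} n {x} {y} eq = begin
  x                                  ≡⟨ Fin.combine-remQuot {m} n x ⟨
  uncurry combine (remQuot {m} n x)  ≡⟨ cong (uncurry combine) eq ⟩
  uncurry combine (remQuot {m} n y)  ≡⟨ Fin.combine-remQuot {m} n y ⟩
  y                                  ∎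
  where open ≡-Reasoning

opposite-injective : ∀ {n} → Injective _≡_ _≡_ (opposite {n})
opposite-injective {x = x} {y} eq = begin
  x                       ≡⟨ Fin.opposite-involutive x ⟨
  opposite (opposite x)   ≡⟨ cong opposite eq ⟩
  opposite (opposite y)   ≡⟨ Fin.opposite-involutive y ⟩
  y                       ∎
  where open ≡-Reasoning

uncurry-combine-injective : ∀ {m n} → Injective _≡_ _≡_ (uncurry (combine {m} {n}))
uncurry-combine-injective eq = uncurry (cong₂ _,_) (Fin.combine-injective _ _ _ _ eq)

side : ∀ {n} → Vertex n → Bool
side (inj₁ _) = false
side (inj₂ _) = true

index : ∀ {n} → Vertex n → Fin n
index (inj₁ i) = i
index (inj₂ i) = i

place : ∀ {n} → Bool → Fin n → Vertex n
place false = inj₁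
place true  = inj₂

place-side-index : ∀ {n} (x : Vertex n) → place (side x) (index x) ≡ x
place-side-index (inj₁ _) = refl
place-side-index (inj₂ _) = refl

adjacent⇒opposite-sides : ∀ {n} (x y : Vertex n) → Adj x y → side y ≡ not (side x)
adjacent⇒opposite-sides (inj₁ _) (inj₂ _) _  = refl
adjacent⇒opposite-sides (inj₂ _) (inj₁ _) _  = refl
adjacent⇒opposite-sides (inj₁ _) (inj₁ _) ()
adjacent⇒opposite-sides (inj₂ _) (inj₂ _) ()

adjacent⇒distinct-indices : ∀ {n} (x y : Vertex n) → Adj x y → index x ≢ index y
adjacent⇒distinct-indices (inj₁ _) (inj₂ _) i≢j = i≢j
adjacent⇒distinct-indices (inj₂ _) (inj₁ _) i≢j = i≢j
adjacent⇒distinct-indices (inj₁ _) (inj₁ _) ()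
adjacent⇒distinct-indices (inj₂ _) (inj₂ _) ()

opposite-nonadjacent⇒same-index : ∀ {n} (x y : Vertex n) →
  side y ≡ not (side x) → ¬ Adj x y → index x ≡ index y
opposite-nonadjacent⇒same-index (inj₁ i) (inj₂ j) _  ¬adj = decidable-stable (i ≟ j) ¬adj
opposite-nonadjacent⇒same-index (inj₂ i) (inj₁ j) _  ¬adj = decidable-stable (i ≟ j) ¬adj
opposite-nonadjacent⇒same-index (inj₁ _) (inj₁ _) () _
opposite-nonadjacent⇒same-index (inj₂ _) (inj₂ _) () _

IsAutomorphism : ∀ {n} → (Vertex n → Vertex n) → Set
IsAutomorphism f = ∀ x y → Adj x y ⇔ Adj (f x) (f y)

antidiag : ∀ {n} → Permutation′ n → Vertex n → Vertex n
antidiag π (inj₁ i) = inj₂ (π ⟨$⟩ʳ i)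
antidiag π (inj₂ i) = inj₁ (π ⟨$⟩ʳ i)

diag⊎antidiag : ∀ {n} {f : Vertex n → Vertex n} (π : Permutation′ n) (b : Bool) →
  (∀ i → f (inj₁ i) ≡ place b (π ⟨$⟩ʳ i)) →
  (∀ i → f (inj₂ i) ≡ place (not b) (π ⟨$⟩ʳ i)) →
  f ≗ diag π ⊎ f ≗ antidiag π
diag⊎antidiag π false f-inj₁ f-inj₂ = inj₁ λ where
  (inj₁ i) → f-inj₁ i
  (inj₂ i) → f-inj₂ i
diag⊎antidiag π true  f-inj₁ f-inj₂ = inj₂ λ where
  (inj₁ i) → f-inj₁ i
  (inj₂ i) → f-inj₂ i

module CrownAutomorphism {m} {f : Vertex (3 + m) → Vertex (3 + m)} (f-aut : IsAutomorphism f)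
  where

  private
    edge : ∀ x y → Adj x y → Adj (f x) (f y)
    edge x y = Equivalence.to (f-aut x y)

    opposite-images : ∀ x y → Adj x y → side (f y) ≡ not (side (f x))
    opposite-images x y adj = adjacent⇒opposite-sides (f x) (f y) (edge x y adj)

  side₀ : Bool
  side₀ = side (f (inj₁ zero))

  -- v_i and v_0 have a common neighbour u_k: this is where n ≥ 3 is needed.
  side-inj₁ : ∀ i → side (f (inj₁ i)) ≡ side₀
  side-inj₁ i with avoid-two zero i
  ... | k , k≢0 , k≢i =
    trans (opposite-images (inj₂ k) (inj₁ i) k≢i)
          (sym (opposite-images (inj₂ k) (inj₁ zero) k≢0))

  side-inj₂ : ∀ i → side (f (inj₂ i)) ≡ not side₀
  side-inj₂ i with avoid-two i i
  ... | k , k≢i , _ = trans (opposite-images (inj₁ k) (inj₂ i) k≢i) (cong not (side-inj₁ k))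

  label : Fin (3 + m) → Fin (3 + m)
  label i = index (f (inj₁ i))

  index-inj₂ : ∀ i → index (f (inj₂ i)) ≡ label i
  index-inj₂ i = sym (opposite-nonadjacent⇒same-index (f (inj₁ i)) (f (inj₂ i))
    (trans (side-inj₂ i) (cong not (sym (side-inj₁ i))))
    (λ adj → Equivalence.from (f-aut (inj₁ i) (inj₂ i)) adj refl))

  label-injective : Injective _≡_ _≡_ label
  label-injective {i} {j} eq = decidable-stable (i ≟ j) λ i≢j →
    adjacent⇒distinct-indices (f (inj₁ i)) (f (inj₂ j)) (edge (inj₁ i) (inj₂ j) i≢j)
      (trans eq (sym (index-inj₂ j)))

  π : Permutation′ (3 + m)
  π = injective⇒permutation label label-injective

  f-inj₁ : ∀ i → f (inj₁ i) ≡ place side₀ (label i)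
  f-inj₁ i = trans (sym (place-side-index (f (inj₁ i))))
                   (cong (λ b → place b (label i)) (side-inj₁ i))

  f-inj₂ : ∀ i → f (inj₂ i) ≡ place (not side₀) (label i)
  f-inj₂ i = trans (sym (place-side-index (f (inj₂ i))))
                   (cong₂ place (side-inj₂ i) (index-inj₂ i))

automorphism⇒diag⊎antidiag : ∀ {m} {f : Vertex (3 + m) → Vertex (3 + m)} →
  IsAutomorphism f → Σ (Permutation′ (3 + m)) λ π → f ≗ diag π ⊎ f ≗ antidiag π
automorphism⇒diag⊎antidiag f-aut = π , diag⊎antidiag π side₀ f-inj₁ f-inj₂
  where open CrownAutomorphism f-aut

codeOf : ∀ {n} {A : Set} → (Vertex n → A) → Fin n → A × A
codeOf c i = c (inj₁ i) , c (inj₂ i)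

colouringOf : ∀ {n} {A : Set} → (Fin n → A × A) → Vertex n → A
colouringOf code (inj₁ i) = proj₁ (code i)
colouringOf code (inj₂ i) = proj₂ (code i)

HasSwapPartner : ∀ {n} {A : Set} → (Fin n → A × A) → Fin n → Set
HasSwapPartner code i = ∃ λ j → code j ≡ swap (code i)

SwapClosed : ∀ {n} {A : Set} → (Fin n → A × A) → Set
SwapClosed code = ∀ i → HasSwapPartner code i

PreservesColours : ∀ {n} {A : Set} → (Vertex n → A) → (Vertex n → Vertex n) → Set
PreservesColours c g = ∀ v → c (g v) ≡ c v

stabilises⇒preservesColours : ∀ {n k} {c : Vertex n → Fin k} {g} →
  (∀ i → StabilisesPart c i g) → PreservesColours c g
stabilises⇒preservesColours {c = c} stab v = proj₁ (stab (c v)) v refl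

preservesColours⇒stabilises : ∀ {n k} {c : Vertex n → Fin k} {g g⁻¹ : Vertex n → Vertex n} →
  (∀ w → g (g⁻¹ w) ≡ w) → PreservesColours c g → ∀ i → StabilisesPart c i g
preservesColours⇒stabilises {c = c} {g} {g⁻¹} g∘g⁻¹ pres i =
  (λ v cv≡i → trans (pres v) cv≡i) ,
  (λ w cw≡i → g⁻¹ w , trans (sym (pres (g⁻¹ w))) (trans (cong c (g∘g⁻¹ w)) cw≡i) , g∘g⁻¹ w)

preservesColours-≗ : ∀ {n} {A : Set} {c : Vertex n → A} {g h} →
  g ≗ h → PreservesColours c g → PreservesColours c h
preservesColours-≗ {c = c} g≗h pres v = trans (cong c (sym (g≗h v))) (pres v)

module _ {n} {A : Set} {c : Vertex n → A} {π : Permutation′ n} where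

  diag-preservesColours : (∀ i → codeOf c (π ⟨$⟩ʳ i) ≡ codeOf c i) →
    PreservesColours c (diag π)
  diag-preservesColours same (inj₁ i) = cong proj₁ (same i)
  diag-preservesColours same (inj₂ i) = cong proj₂ (same i)

  antidiag-preservesColours : (∀ i → codeOf c (π ⟨$⟩ʳ i) ≡ swap (codeOf c i)) →
    PreservesColours c (antidiag π)
  antidiag-preservesColours swapped (inj₁ i) = cong proj₂ (swapped i)
  antidiag-preservesColours swapped (inj₂ i) = cong proj₁ (swapped i)

  diag-preservesColours⇒identity : Injective _≡_ _≡_ (codeOf c) → PreservesColours c (diag π) →
    diag π ≗ id
  diag-preservesColours⇒identity code-inj pres = λ where
      (inj₁ i) → cong inj₁ (fixed i)
      (inj₂ i) → cong inj₂ (fixed i)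
    where
    fixed : ∀ i → π ⟨$⟩ʳ i ≡ i
    fixed i = code-inj (cong₂ _,_ (pres (inj₁ i)) (pres (inj₂ i)))

  antidiag-preservesColours⇒swapClosed : PreservesColours c (antidiag π) →
    SwapClosed (codeOf c)
  antidiag-preservesColours⇒swapClosed pres i =
    π ⟨$⟩ʳ i , cong₂ _,_ (pres (inj₂ i)) (pres (inj₁ i))

injective⇒swapClosed : ∀ {n k} → k * k ≤ n → (code : Fin n → Fin k × Fin k) →
  Injective _≡_ _≡_ code → SwapClosed code
injective⇒swapClosed k²≤n code code-inj i =
  j , uncurry-combine-injective combine-code-j≡
  where
  onto = injective⇒strictlySurjective k²≤n (uncurry combine ∘ code)
           (code-inj ∘ uncurry-combine-injective)
  j = proj₁ (onto (uncurry combine (swap (code i))))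
  combine-code-j≡ = proj₂ (onto (uncurry combine (swap (code i))))

-- Only indices < n are coded, so the pair of the last index, (k , k) before `opposite` and
-- (k , 0) after it, is missed; it is the swap of code zero = (0 , k).
asymmetric-code : ∀ {n k} → suc n < suc k * suc k →
  Σ (Fin (suc n) → Fin (suc k) × Fin (suc k)) λ code →
    Injective _≡_ _≡_ code × ¬ HasSwapPartner code zero
asymmetric-code {n} {k} (s≤s n<m) = code , code-injective , no-partner
  where
  embed : Fin (suc n) → Fin (suc (k + k * suc k))
  embed i = inject₁ (inject≤ i n<m)

  code : Fin (suc n) → Fin (suc k) × Fin (suc k)
  code i = map₂ opposite (remQuot (suc k) (embed i))

  code-injective : Injective _≡_ _≡_ code
  code-injective {i} {j} eq = Fin.inject≤-injective n<m n<m i j (Fin.inject₁-injective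
    (remQuot-injective (suc k) (cong₂ _,_ (cong proj₁ eq) (opposite-injective (cong proj₂ eq)))))

  code-zero : code zero ≡ (zero , fromℕ k)
  code-zero = cong (map₂ opposite ∘ remQuot (suc k))
    (Fin.toℕ-injective (trans (Fin.toℕ-inject₁ _) (Fin.toℕ-inject≤ zero n<m)))

  no-partner : ¬ HasSwapPartner code zero
  no-partner (j , code-j≡swap) = Fin.fromℕ≢inject₁ (begin
    fromℕ (k + k * suc k)                                ≡⟨ combine-fromℕ k k ⟨
    combine (fromℕ k) (fromℕ k)                          ≡⟨ cong (uncurry combine) remQuot-embed-j ⟨
    uncurry combine (remQuot {suc k} (suc k) (embed j))  ≡⟨ Fin.combine-remQuot (suc k) (embed j) ⟩
    embed j                                              ∎)
    where
    open ≡-Reasoning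
    code-j≡ : code j ≡ (fromℕ k , zero)
    code-j≡ = trans code-j≡swap (cong swap code-zero)
    remQuot-embed-j : remQuot {suc k} (suc k) (embed j) ≡ (fromℕ k , fromℕ k)
    remQuot-embed-j = cong₂ _,_ (cong proj₁ code-j≡)
      (trans (sym (Fin.opposite-involutive _)) (cong (opposite ∘ proj₂) code-j≡))

preservesColours⇒identity : ∀ {m} {A : Set} (c : Vertex (3 + m) → A) →
  Injective _≡_ _≡_ (codeOf c) → (i : Fin (3 + m)) → ¬ HasSwapPartner (codeOf c) i →
  ∀ {g} → IsAutomorphism g → PreservesColours c g → g ≗ id
preservesColours⇒identity c code-inj i lonely g-aut pres with automorphism⇒diag⊎antidiag g-aut
... | π , inj₁ g≗diag =
  λ v → trans (g≗diag v)
    (diag-preservesColours⇒identity code-inj (preservesColours-≗ g≗diag pres) v)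
... | π , inj₂ g≗antidiag =
  ⊥-elim (lonely (antidiag-preservesColours⇒swapClosed (preservesColours-≗ g≗antidiag pres) i))

upper-bound : ∀ {m k} {G : VSet (3 + m)} → IsAutSubgroup G → 3 + m < suc k * suc k →
  Distinguishing G (suc k)
upper-bound G-aut n<K² with asymmetric-code n<K²
... | code , code-inj , lonely = colouringOf code , λ g g∈G stab →
  preservesColours⇒identity (colouringOf code) code-inj zero lonely
    (IsAutSubgroup.isAut G-aut g∈G) (stabilises⇒preservesColours stab)

module LowerBound {m} {G : VSet (3 + m)} (G-aut : IsAutSubgroup G) (G⁺≐Diag : GPlus G ≐ Diag)
  (G-transitive : VertexTransitive G) where

  open IsAutSubgroup G-aut

  diag∈G : ∀ π → G (diag π)
  diag∈G π = proj₁ (Equivalence.from (G⁺≐Diag (diag π)) (π , λ _ → refl))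

  antidiag∈G : ∀ π → G (antidiag π)
  antidiag∈G π with G-transitive (inj₁ zero) (inj₂ zero)
  ... | g₀ , g₀∈G , g₀v₀≡u₀ with automorphism⇒diag⊎antidiag (isAut g₀∈G)
  ...   | _ , inj₁ g₀≗diag =
    contradiction (trans (sym (g₀≗diag (inj₁ zero))) g₀v₀≡u₀) λ ()
  ...   | σ , inj₂ g₀≗antidiag =
    respects factorisation (closed∘ g₀∈G (diag∈G (π ∘ₚ Perm.flip σ)))
    where
    factorisation : ∀ v → g₀ (diag (π ∘ₚ Perm.flip σ) v) ≡ antidiag π v
    factorisation (inj₁ i) = trans (g₀≗antidiag _) (cong inj₂ (Perm.inverseʳ σ))
    factorisation (inj₂ i) = trans (g₀≗antidiag _) (cong inj₁ (Perm.inverseʳ σ))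

  module _ {k} (c : Vertex (3 + m) → Fin k)
    (c-distinguishes : ∀ g → G g → (∀ i → StabilisesPart c i g) → ∀ v → g v ≡ v) where

    code-injective : Injective _≡_ _≡_ (codeOf c)
    code-injective {i} {j} code-i≡code-j =
      trans (sym (cong index (c-distinguishes (diag τ) (diag∈G τ) stab (inj₁ i))))
            (transpose-i≡j i j)
      where
      τ = Perm.transpose i j
      diag-inverse : ∀ w → diag τ (diag (Perm.flip τ) w) ≡ w
      diag-inverse (inj₁ _) = cong inj₁ (Perm.inverseʳ τ)
      diag-inverse (inj₂ _) = cong inj₂ (Perm.inverseʳ τ)
      stab = preservesColours⇒stabilises diag-inverse
        (diag-preservesColours (transpose-preserves (codeOf c) i j code-i≡code-j))

    ¬swapClosed : ¬ SwapClosed (codeOf c)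
    ¬swapClosed partner =
      contradiction (c-distinguishes (antidiag ρ) (antidiag∈G ρ) stab (inj₁ zero)) λ ()
      where
      h : Fin (3 + m) → Fin (3 + m)
      h i = proj₁ (partner i)
      h-involutive : ∀ i → h (h i) ≡ i
      h-involutive i =
        code-injective (trans (proj₂ (partner (h i))) (cong swap (proj₂ (partner i))))
      ρ = permutation h h h-involutive h-involutive
      antidiag-involutive : ∀ w → antidiag ρ (antidiag ρ w) ≡ w
      antidiag-involutive (inj₁ i) = cong inj₁ (h-involutive i)
      antidiag-involutive (inj₂ i) = cong inj₂ (h-involutive i)
      stab = preservesColours⇒stabilises antidiag-involutive
        (antidiag-preservesColours (proj₂ ∘ partner))

  lower-bound : ∀ {k} → k * k ≤ 3 + m → ¬ Distinguishing G k
  lower-bound k²≤n (c , c-distinguishes) =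
    ¬swapClosed c c-distinguishes
      (injective⇒swapClosed k²≤n (codeOf c) (code-injective c c-distinguishes))

proposition4p3 : (n : ℕ) → 3 ≤ n → (G : VSet n) → IsAutSubgroup G →
    VertexTransitive G → EdgeTransitive G → GPlus G ≐ Diag →
    (s : ℕ) → s * s ≤ n → n < suc s * suc s →
    DistNumberIs G (suc s)
proposition4p3 (suc (suc (suc m))) (s≤s (s≤s (s≤s z≤n)))
  G G-aut G-transitive _ G⁺≐Diag s s²≤n n<S² = upper-bound G-aut n<S² , fewer-colours-fail
  where
  fewer-colours-fail : ∀ k → k < suc s → ¬ Distinguishing G k
  fewer-colours-fail k (s≤s k≤s) = LowerBound.lower-bound G-aut G⁺≐Diag G-transitive
    (ℕ.≤-trans (ℕ.*-mono-≤ k≤s k≤s) s²≤n)
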